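{- Let $I$ be a small category, $(\mathcal{L}(i))_{i \in I}$ a family of complete Heyting algebras, and $(A,\alpha)$ an object of $\mathbf{FuzzyPresheaf}(I,\mathcal{L})$. Then the functor $-\times(A,\alpha)$ is left adjoint to the functor $-^{(A,\alpha)}$ on $\mathbf{FuzzyPresheaf}(I,\mathcal{L})$, where these functors are defined as follows. For $(C,\gamma)$, $(C,\gamma)\times(A,\alpha) = (C\times A, \gamma\pi_1\wedge\alpha\pi_2)$ (pointwise product of presheaves, membership $(c,a)\mapsto \gamma_i(c)\wedge\alpha_i(a)$), and on morphisms $f\mapsto f\times \mathrm{id}_A$. For $(B,\beta)$, $(B,\beta)^{(A,\alpha)} = (E,\theta)$ where $E(i)$ is the set of natural transformations $y(i)\times A\Rightarrow B$ (with $y(i)=I(-,i)$ the representable presheaf), $E(\iota: j\to i)$ is precomposition with $y(\iota)\times\mathrm{id}_A$, and $$\theta_i(m)=\bigwedge_{a\in A(i)}\big(\alpha_i(a)\Rightarrow \beta_i(m_i(\mathrm{id}_i,a))\big);$$ on morphisms $g:(B,\beta)\to(B',\beta')$, $g^{(A,\alpha)}$ is postcomposition by $g$.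
   Context: An $\mathcal{L}$-fuzzy presheaf is a pair $(A,\alpha)$ where $A: I^{op}\to \mathbf{Set}$ is a functor and $\alpha=(\alpha_i : A(i)\to \mathcal{L}(i))_{i\in I}$ is a family of functions. A morphism $f:(A,\alpha)\to(B,\beta)$ is a natural transformation $f:A\to B$ with $\alpha_i \leq \beta_i f_i$ pointwise for all $i$. In a Heyting algebra, $a\Rightarrow b$ denotes the relative pseudo-complement: $c\wedge a\leq b$ iff $c\leq a\Rightarrow b$. For $\iota: j\to i$ in $I$, $y(\iota): I(-,j)\to I(-,i)$ is postcomposition with $\iota$. -}

module Defs where

open import Level using (Level; _⊔_; 0ℓ) renaming (suc to lsuc)
open import Relation.Binary.Bundles using (Setoid)
open import Relation.Binary.Lattice.Bundles using (HeytingAlgebra)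
open import Data.Product using (_×_; _,_; proj₁; proj₂)
open import Data.Product.Relation.Binary.Pointwise.NonDependent using (×-setoid)
import Relation.Binary.Lattice.Properties.HeytingAlgebra as HAProps
import Relation.Binary.Lattice.Properties.MeetSemilattice as MSProps

record Category (o h e : Level) : Set (lsuc (o ⊔ h ⊔ e)) where
  infixr 9 _∘_
  infix 4 _≈_
  field
    Obj       : Set o
    _⇒_       : Obj → Obj → Set h
    _≈_       : ∀ {A B} → A ⇒ B → A ⇒ B → Set e
    id        : ∀ {A} → A ⇒ A
    _∘_       : ∀ {A B C} → B ⇒ C → A ⇒ B → A ⇒ C
    ≈-refl    : ∀ {A B} {f : A ⇒ B} → f ≈ f
    ≈-sym     : ∀ {A B} {f g : A ⇒ B} → f ≈ g → g ≈ f
    ≈-trans   : ∀ {A B} {f g k : A ⇒ B} → f ≈ g → g ≈ k → f ≈ k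
    ∘-resp-≈  : ∀ {A B C} {f f' : B ⇒ C} {g g' : A ⇒ B} → f ≈ f' → g ≈ g' → f ∘ g ≈ f' ∘ g'
    identityˡ : ∀ {A B} {f : A ⇒ B} → id ∘ f ≈ f
    identityʳ : ∀ {A B} {f : A ⇒ B} → f ∘ id ≈ f
    assoc     : ∀ {A B C D} {f : C ⇒ D} {g : B ⇒ C} {k : A ⇒ B} → (f ∘ g) ∘ k ≈ f ∘ (g ∘ k)

SmallCategory : Set₁
SmallCategory = Category 0ℓ 0ℓ 0ℓ

record Functor {o h e o' h' e'} (C : Category o h e) (D : Category o' h' e')
       : Set (o ⊔ h ⊔ e ⊔ o' ⊔ h' ⊔ e') where
  private
    module C = Category C
    module D = Category D
  field
    F₀           : C.Obj → D.Obj
    F₁           : ∀ {X Y} → X C.⇒ Y → F₀ X D.⇒ F₀ Y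
    F-resp-≈     : ∀ {X Y} {f g : X C.⇒ Y} → f C.≈ g → F₁ f D.≈ F₁ g
    identity     : ∀ {X} → F₁ (C.id {X}) D.≈ D.id
    homomorphism : ∀ {X Y Z} {f : X C.⇒ Y} {g : Y C.⇒ Z} → F₁ (g C.∘ f) D.≈ F₁ g D.∘ F₁ f

record Adjunction {o h e o' h' e'} {C : Category o h e} {D : Category o' h' e'}
       (F : Functor C D) (G : Functor D C) : Set (o ⊔ h ⊔ e ⊔ o' ⊔ h' ⊔ e') where
  private
    module C = Category C
    module D = Category D
    module F = Functor F
    module G = Functor G
  field
    φ       : ∀ {X Y} → F.F₀ X D.⇒ Y → X C.⇒ G.F₀ Y
    ψ       : ∀ {X Y} → X C.⇒ G.F₀ Y → F.F₀ X D.⇒ Y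
    φ-cong  : ∀ {X Y} {f g : F.F₀ X D.⇒ Y} → f D.≈ g → φ f C.≈ φ g
    ψ-cong  : ∀ {X Y} {f g : X C.⇒ G.F₀ Y} → f C.≈ g → ψ f D.≈ ψ g
    ψ∘φ     : ∀ {X Y} (f : F.F₀ X D.⇒ Y) → ψ (φ f) D.≈ f
    φ∘ψ     : ∀ {X Y} (g : X C.⇒ G.F₀ Y) → φ (ψ g) C.≈ g
    natural : ∀ {X X' Y Y'} (k : X' C.⇒ X) (g : Y D.⇒ Y') (f : F.F₀ X D.⇒ Y) →
              φ (g D.∘ f D.∘ F.F₁ k) C.≈ G.F₁ g C.∘ φ f C.∘ k

record CompleteHeytingAlgebra : Set₁ where
  field
    heytingAlgebra : HeytingAlgebra 0ℓ 0ℓ 0ℓ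
  open HeytingAlgebra heytingAlgebra public
  field
    ⋀          : {X : Set} → (X → Carrier) → Carrier
    ⋀-lower    : ∀ {X} (f : X → Carrier) (x : X) → ⋀ f ≤ f x
    ⋀-greatest : ∀ {X} (f : X → Carrier) {z : Carrier} → (∀ x → z ≤ f x) → z ≤ ⋀ f

module CHAProps (L : CompleteHeytingAlgebra) where
  open CompleteHeytingAlgebra L
  open HAProps heytingAlgebra public using (⇨-cong; ⇨ʳ-covariant)
  open MSProps meetSemilattice public using (∧-cong; ∧-monotonic)

  ⋀-mono : ∀ {X} {f g : X → Carrier} → (∀ x → f x ≤ g x) → ⋀ f ≤ ⋀ g
  ⋀-mono {f = f} {g} p = ⋀-greatest g (λ x → trans (⋀-lower f x) (p x))

  ⋀-cong : ∀ {X} {f g : X → Carrier} → (∀ x → f x ≈ g x) → ⋀ f ≈ ⋀ g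
  ⋀-cong p = antisym (⋀-mono (λ x → reflexive (p x)))
                     (⋀-mono (λ x → reflexive (Eq.sym (p x))))

module FuzzyPresheaves (I : SmallCategory) (L : Category.Obj I → CompleteHeytingAlgebra) where
  open Category I
  module L i = CompleteHeytingAlgebra (L i)
  module LP i = CHAProps (L i)
  open Setoid using (Carrier)

  record Presheaf : Set₁ where
    field
      F₀          : Obj → Setoid 0ℓ 0ℓ
      F₁          : ∀ {i j} → j ⇒ i → Carrier (F₀ i) → Carrier (F₀ j)
      F₁-cong     : ∀ {i j} (f : j ⇒ i) {x y} → Setoid._≈_ (F₀ i) x y →
                    Setoid._≈_ (F₀ j) (F₁ f x) (F₁ f y)
      F₁-resp-≈   : ∀ {i j} {f g : j ⇒ i} (x : Carrier (F₀ i)) → f ≈ g →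
                    Setoid._≈_ (F₀ j) (F₁ f x) (F₁ g x)
      F-identity  : ∀ {i} (x : Carrier (F₀ i)) → Setoid._≈_ (F₀ i) (F₁ id x) x
      F-homomorphism : ∀ {i j k} (f : j ⇒ i) (g : k ⇒ j) (x : Carrier (F₀ i)) →
                    Setoid._≈_ (F₀ k) (F₁ (f ∘ g) x) (F₁ g (F₁ f x))

  record FuzzyPresheaf : Set₁ where
    field
      presheaf : Presheaf
    open Presheaf presheaf public
    field
      α      : ∀ i → Carrier (F₀ i) → L.Carrier i
      α-cong : ∀ i {x y} → Setoid._≈_ (F₀ i) x y → L._≈_ i (α i x) (α i y)

  record Hom (A B : FuzzyPresheaf) : Set where
    private
      module A = FuzzyPresheaf A
      module B = FuzzyPresheaf B
    field
      η       : ∀ i → Carrier (A.F₀ i) → Carrier (B.F₀ i)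
      η-cong  : ∀ i {x y} → Setoid._≈_ (A.F₀ i) x y → Setoid._≈_ (B.F₀ i) (η i x) (η i y)
      natural : ∀ {i j} (f : j ⇒ i) (x : Carrier (A.F₀ i)) →
                Setoid._≈_ (B.F₀ j) (η j (A.F₁ f x)) (B.F₁ f (η i x))
      fuzzy   : ∀ i (x : Carrier (A.F₀ i)) → L._≤_ i (A.α i x) (B.α i (η i x))

  open Hom public

  _≈H_ : ∀ {A B} → Hom A B → Hom A B → Set
  _≈H_ {A} {B} f g = ∀ i (x : Carrier (FuzzyPresheaf.F₀ A i)) →
                     Setoid._≈_ (FuzzyPresheaf.F₀ B i) (η f i x) (η g i x)

  idH : ∀ {A} → Hom A A
  idH {A} = record
    { η = λ i x → x ; η-cong = λ i p → p
    ; natural = λ f x → Setoid.refl (F₀ _)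
    ; fuzzy = λ i x → L.refl i }
    where open FuzzyPresheaf A

  _∘H_ : ∀ {A B C} → Hom B C → Hom A B → Hom A C
  _∘H_ {A} {B} {C} g f = record
    { η = λ i x → η g i (η f i x)
    ; η-cong = λ i p → η-cong g i (η-cong f i p)
    ; natural = λ h x → Setoid.trans (C.F₀ _) (η-cong g _ (natural f h x)) (natural g h (η f _ x))
    ; fuzzy = λ i x → L.trans i (fuzzy f i x) (fuzzy g i (η f i x)) }
    where
      module C = FuzzyPresheaf C

  FuzzyPresheafCat : Category (lsuc 0ℓ) 0ℓ 0ℓ
  FuzzyPresheafCat = record
    { Obj = FuzzyPresheaf
    ; _⇒_ = Hom
    ; _≈_ = _≈H_
    ; id = idH
    ; _∘_ = _∘H_
    ; ≈-refl = λ {_} {B} i x → Setoid.refl (FuzzyPresheaf.F₀ B i)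
    ; ≈-sym = λ {_} {B} p i x → Setoid.sym (FuzzyPresheaf.F₀ B i) (p i x)
    ; ≈-trans = λ {_} {B} p q i x → Setoid.trans (FuzzyPresheaf.F₀ B i) (p i x) (q i x)
    ; ∘-resp-≈ = λ {_} {_} {C} {f} {f'} {g} {g'} p q i x →
        Setoid.trans (FuzzyPresheaf.F₀ C i) (η-cong f i (q i x)) (p i (η g' i x))
    ; identityˡ = λ {_} {B} i x → Setoid.refl (FuzzyPresheaf.F₀ B i)
    ; identityʳ = λ {_} {B} i x → Setoid.refl (FuzzyPresheaf.F₀ B i)
    ; assoc = λ {_} {_} {_} {D} i x → Setoid.refl (FuzzyPresheaf.F₀ D i)
    }

  module _ (A : FuzzyPresheaf) where
    private module A = FuzzyPresheaf A

    _×A : FuzzyPresheaf → FuzzyPresheaf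
    C ×A = record
      { presheaf = record
        { F₀ = λ i → ×-setoid (C.F₀ i) (A.F₀ i)
        ; F₁ = λ f ca → C.F₁ f (proj₁ ca) , A.F₁ f (proj₂ ca)
        ; F₁-cong = λ f p → C.F₁-cong f (proj₁ p) , A.F₁-cong f (proj₂ p)
        ; F₁-resp-≈ = λ x p → C.F₁-resp-≈ (proj₁ x) p , A.F₁-resp-≈ (proj₂ x) p
        ; F-identity = λ x → C.F-identity (proj₁ x) , A.F-identity (proj₂ x)
        ; F-homomorphism = λ f g x → C.F-homomorphism f g (proj₁ x) , A.F-homomorphism f g (proj₂ x)
        }
      ; α = λ i ca → L._∧_ i (C.α i (proj₁ ca)) (A.α i (proj₂ ca))
      ; α-cong = λ i p → LP.∧-cong i (C.α-cong i (proj₁ p)) (A.α-cong i (proj₂ p))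
      }
      where module C = FuzzyPresheaf C

    _×A₁ : ∀ {C C'} → Hom C C' → Hom (C ×A) (C' ×A)
    _×A₁ {C} {C'} f = record
      { η = λ i ca → η f i (proj₁ ca) , proj₂ ca
      ; η-cong = λ i p → η-cong f i (proj₁ p) , proj₂ p
      ; natural = λ h x → natural f h (proj₁ x) , Setoid.refl (A.F₀ _)
      ; fuzzy = λ i x → LP.∧-monotonic i (fuzzy f i (proj₁ x)) (L.refl i)
      }

    -×A : Functor FuzzyPresheafCat FuzzyPresheafCat
    -×A = record
      { F₀ = _×A
      ; F₁ = _×A₁
      ; F-resp-≈ = λ {_} {_} {f} {g} p i x → p i (proj₁ x) , Setoid.refl (A.F₀ i)
      ; identity = λ {X} i x → Setoid.refl (FuzzyPresheaf.F₀ (X ×A) i)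
      ; homomorphism = λ {_} {_} {Z} i x → Setoid.refl (FuzzyPresheaf.F₀ (Z ×A) i)
      }

    -- Natural transformations y(i) × A ⇒ B, where y(i) = I(-,i)
    record Exp (B : FuzzyPresheaf) (i : Obj) : Set where
      private module B = FuzzyPresheaf B
      field
        comp     : ∀ k → k ⇒ i → Carrier (A.F₀ k) → Carrier (B.F₀ k)
        comp-cong : ∀ k {h h' : k ⇒ i} {a a'} → h ≈ h' → Setoid._≈_ (A.F₀ k) a a' →
                    Setoid._≈_ (B.F₀ k) (comp k h a) (comp k h' a')
        comp-nat : ∀ {k l} (ι : l ⇒ k) (h : k ⇒ i) (a : Carrier (A.F₀ k)) →
                   Setoid._≈_ (B.F₀ l) (comp l (h ∘ ι) (A.F₁ ι a)) (B.F₁ ι (comp k h a))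
    open Exp public

    module _ (B : FuzzyPresheaf) where
      private module B = FuzzyPresheaf B

      ExpSetoid : Obj → Setoid 0ℓ 0ℓ
      ExpSetoid i = record
        { Carrier = Exp B i
        ; _≈_ = λ m m' → ∀ k (h : k ⇒ i) a → Setoid._≈_ (B.F₀ k) (comp m k h a) (comp m' k h a)
        ; isEquivalence = record
          { refl = λ k h a → Setoid.refl (B.F₀ k)
          ; sym = λ p k h a → Setoid.sym (B.F₀ k) (p k h a)
          ; trans = λ p q k h a → Setoid.trans (B.F₀ k) (p k h a) (q k h a) } }

      Exp₁ : ∀ {i j} → j ⇒ i → Exp B i → Exp B j
      Exp₁ ι m = record
        { comp = λ k h a → comp m k (ι ∘ h) a
        ; comp-cong = λ k p q → comp-cong m k (∘-resp-≈ ≈-refl p) q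
        ; comp-nat = λ κ h a → Setoid.trans (B.F₀ _)
            (comp-cong m _ (≈-sym assoc) (Setoid.refl (A.F₀ _))) (comp-nat m κ (ι ∘ h) a)
        }

      θ : ∀ i → Exp B i → L.Carrier i
      θ i m = L.⋀ i (λ (a : Carrier (A.F₀ i)) → L._⇨_ i (A.α i a) (B.α i (comp m i id a)))

      _^A : FuzzyPresheaf
      _^A = record
        { presheaf = record
          { F₀ = ExpSetoid
          ; F₁ = Exp₁
          ; F₁-cong = λ ι p k h a → p k (ι ∘ h) a
          ; F₁-resp-≈ = λ m p k h a → comp-cong m k (∘-resp-≈ p ≈-refl) (Setoid.refl (A.F₀ k))
          ; F-identity = λ m k h a → comp-cong m k identityˡ (Setoid.refl (A.F₀ k))
          ; F-homomorphism = λ f g m k h a → comp-cong m k assoc (Setoid.refl (A.F₀ k))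
          }
        ; α = θ
        ; α-cong = λ i p → LP.⋀-cong i (λ a → LP.⇨-cong i (L.Eq.refl i) (B.α-cong i (p i id a)))
        }

    _^A₁ : ∀ {B B'} → Hom B B' → Hom (B ^A) (B' ^A)
    _^A₁ {B} {B'} g = record
      { η = λ i m → record
          { comp = λ k h a → η g k (comp m k h a)
          ; comp-cong = λ k p q → η-cong g k (comp-cong m k p q)
          ; comp-nat = λ ι h a → Setoid.trans (B'.F₀ _)
              (η-cong g _ (comp-nat m ι h a)) (natural g ι (comp m _ h a))
          }
      ; η-cong = λ i p k h a → η-cong g k (p k h a)
      ; natural = λ f m k h a → Setoid.refl (B'.F₀ k)
      ; fuzzy = λ i m → LP.⋀-mono i (λ a → LP.⇨ʳ-covariant i (fuzzy g i (comp m i id a)))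
      }
      where module B' = FuzzyPresheaf B'

    -^A : Functor FuzzyPresheafCat FuzzyPresheafCat
    -^A = record
      { F₀ = _^A
      ; F₁ = _^A₁
      ; F-resp-≈ = λ p i m k h a → p k (comp m k h a)
      ; identity = λ {X} i m k h a → Setoid.refl (FuzzyPresheaf.F₀ X k)
      ; homomorphism = λ {_} {_} {Z} i m k h a → Setoid.refl (FuzzyPresheaf.F₀ Z k)
      }

-- Pointwise, the hom-set bijection is currying through the Yoneda lemma: a section
-- c ∈ X(i) is a transformation y(i) ⇒ X, so f : X × A ⇒ Y sends c to
-- f ∘ (c × id_A) : y(i) × A ⇒ Y, and conversely g : X ⇒ Y^A is undone by
-- evaluating g_i(c) at (id_i, a). The membership degrees are compatible because
-- γ(c) ∧ α(a) ≤ β(f(c,a)) for all a is, by ∧ ⊣ ⇨ and the universal property of ⋀,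
-- the same as γ(c) ≤ ⋀_a (α(a) ⇒ β(f(c,a))) = θ(curry f c).

module Submission where

open import Defs
open import Data.Product using (_,_)
open import Relation.Binary.Bundles using (Setoid)
import Relation.Binary.Reasoning.Setoid as SetoidReasoning

module CompleteHeytingAlgebraProperties (L : CompleteHeytingAlgebra) where
  open CompleteHeytingAlgebra L

  ≤-⋀-⇨⇒∧-≤ : ∀ {X : Set} {z} {a b : X → Carrier} →
              z ≤ ⋀ (λ x → a x ⇨ b x) → ∀ x → z ∧ a x ≤ b x
  ≤-⋀-⇨⇒∧-≤ {a = a} {b} z≤⋀ x = transpose-∧ (trans z≤⋀ (⋀-lower (λ x → a x ⇨ b x) x))

  ∧-≤⇒≤-⋀-⇨ : ∀ {X : Set} {z} {a b : X → Carrier} →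
              (∀ x → z ∧ a x ≤ b x) → z ≤ ⋀ (λ x → a x ⇨ b x)
  ∧-≤⇒≤-⋀-⇨ z∧a≤b = ⋀-greatest _ (λ x → transpose-⇨ (z∧a≤b x))

module Currying (I : SmallCategory) (L : Category.Obj I → CompleteHeytingAlgebra)
                (A : FuzzyPresheaves.FuzzyPresheaf I L) where
  open Category I
  open FuzzyPresheaves I L
  open Setoid using (Carrier)
  private
    module A = FuzzyPresheaf A
    module LH i = CompleteHeytingAlgebraProperties (L i)

  module _ {X Y : FuzzyPresheaf} where
    private
      module X = FuzzyPresheaf X
      module Y = FuzzyPresheaf Y

    curryAt : Hom (_×A A X) Y → ∀ {i} → Carrier (X.F₀ i) → Exp A Y i
    curryAt f c = record
      { comp      = λ k h a → η f k (X.F₁ h c , a)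
      ; comp-cong = λ k h≈h' a≈a' → η-cong f k (X.F₁-resp-≈ c h≈h' , a≈a')
      ; comp-nat  = λ ι h a → Setoid.trans (Y.F₀ _)
          (η-cong f _ (X.F-homomorphism h ι c , Setoid.refl (A.F₀ _)))
          (natural f ι (X.F₁ h c , a))
      }

    curryAt-id : (f : Hom (_×A A X) Y) {i : Obj}
                 (c : Carrier (X.F₀ i)) (a : Carrier (A.F₀ i)) →
                 Setoid._≈_ (Y.F₀ i) (comp (curryAt f c) i id a) (η f i (c , a))
    curryAt-id f {i} c a = η-cong f i (X.F-identity c , Setoid.refl (A.F₀ i))

    curry : Hom (_×A A X) Y → Hom X (_^A A Y)
    curry f = record
      { η       = λ i → curryAt f
      ; η-cong  = λ i c≈c' k h a → η-cong f k (X.F₁-cong h c≈c' , Setoid.refl (A.F₀ k))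
      ; natural = λ ι c k h a →
          η-cong f k (Setoid.sym (X.F₀ k) (X.F-homomorphism ι h c) , Setoid.refl (A.F₀ k))
      ; fuzzy   = λ i c → LH.∧-≤⇒≤-⋀-⇨ i (λ a → L.trans i (fuzzy f i (c , a))
          (L.reflexive i (Y.α-cong i (Setoid.sym (Y.F₀ i) (curryAt-id f c a)))))
      }

    evaluation-natural : (g : Hom X (_^A A Y)) {i j : Obj} (ι : j ⇒ i)
                         (c : Carrier (X.F₀ i)) (a : Carrier (A.F₀ i)) →
                         Setoid._≈_ (Y.F₀ j) (comp (η g j (X.F₁ ι c)) j id (A.F₁ ι a))
                                             (Y.F₁ ι (comp (η g i c) i id a))
    evaluation-natural g {i} {j} ι c a = begin
      comp (η g j (X.F₁ ι c)) j id (A.F₁ ι a) ≈⟨ natural g ι c j id (A.F₁ ι a) ⟩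
      comp (η g i c) j (ι ∘ id) (A.F₁ ι a)    ≈⟨ comp-cong (η g i c) j ι∘id≈id∘ι (Setoid.refl (A.F₀ j)) ⟩
      comp (η g i c) j (id ∘ ι) (A.F₁ ι a)    ≈⟨ comp-nat (η g i c) ι id a ⟩
      Y.F₁ ι (comp (η g i c) i id a)          ∎
      where
        open SetoidReasoning (Y.F₀ j)
        ι∘id≈id∘ι : ι ∘ id ≈ id ∘ ι
        ι∘id≈id∘ι = ≈-trans identityʳ (≈-sym identityˡ)

    uncurry : Hom X (_^A A Y) → Hom (_×A A X) Y
    uncurry g = record
      { η       = λ i (c , a) → comp (η g i c) i id a
      ; η-cong  = λ i {(c , a)} {(c' , a')} (c≈c' , a≈a') → Setoid.trans (Y.F₀ i)
          (η-cong g i c≈c' i id a) (comp-cong (η g i c') i ≈-refl a≈a')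
      ; natural = λ ι (c , a) → evaluation-natural g ι c a
      ; fuzzy   = λ i (c , a) → LH.≤-⋀-⇨⇒∧-≤ i (fuzzy g i c) a
      }

    uncurry-curry : (f : Hom (_×A A X) Y) → uncurry (curry f) ≈H f
    uncurry-curry f i (c , a) = curryAt-id f c a

    curry-uncurry : (g : Hom X (_^A A Y)) → curry (uncurry g) ≈H g
    curry-uncurry g i c k h a = Setoid.trans (Y.F₀ k)
      (natural g h c k id a) (comp-cong (η g i c) k identityʳ (Setoid.refl (A.F₀ k)))

  curry-natural : ∀ {X X' Y Y'} (k : Hom X' X) (g : Hom Y Y') (f : Hom (_×A A X) Y) →
                  curry (g ∘H (f ∘H (_×A₁ A k))) ≈H ((_^A₁ A g) ∘H (curry f ∘H k))
  curry-natural k g f i x k' h a =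
    η-cong g k' (η-cong f k' (natural k h x , Setoid.refl (A.F₀ k')))

  adjunction : Adjunction (-×A A) (-^A A)
  adjunction = record
    { φ       = curry
    ; ψ       = uncurry
    ; φ-cong  = λ {X} f≈f' i c k h a → f≈f' k (FuzzyPresheaf.F₁ X h c , a)
    ; ψ-cong  = λ g≈g' i (c , a) → g≈g' i c i id a
    ; ψ∘φ     = uncurry-curry
    ; φ∘ψ     = curry-uncurry
    ; natural = curry-natural
    }

lemma30 : (I : SmallCategory) (L : Category.Obj I → CompleteHeytingAlgebra)
          (A : FuzzyPresheaves.FuzzyPresheaf I L) →
          Adjunction (FuzzyPresheaves.-×A I L A) (FuzzyPresheaves.-^A I L A)
lemma30 I L A = Currying.adjunction I L A
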